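{- Let $N$ be a positive integer. The identity $m\lceil\sqrt{3N}\rceil=\lceil m\sqrt{3N}\rceil$ holds for all integers $m\geq2$ if and only if $N=3t^2$ for some integer $t\geq1$. -}

module Defs where

open import Data.Nat using (ℕ; _*_; _≤_)
open import Data.Product using (_×_)

-- For a natural number k, c is the ceiling of √k, i.e. the least natural
-- number c with √k ≤ c (equivalently k ≤ c²).
IsCeilSqrt : ℕ → ℕ → Set
IsCeilSqrt k c = (k ≤ c * c) × (∀ d → k ≤ d * d → c ≤ d)

-- ⌈ m √k ⌉ = ⌈ √(m² k) ⌉ for natural m.
IsCeilMulSqrt : ℕ → ℕ → ℕ → Set
IsCeilMulSqrt m k c = IsCeilSqrt (m * m * k) c

-- If 3N = s² is a square then ⌈√(3N)⌉ = s and ⌈m√(3N)⌉ = ⌈√((ms)²)⌉ = ms for every m.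
-- Conversely, let c = ⌈√(3N)⌉ and suppose 3N < c², i.e. 3N ≤ c² − 1. For m = 2c,
-- (2c)²·3N ≤ 4c²(c² − 1) < (2c² − 1)², so ⌈2c√(3N)⌉ ≤ 2c² − 1 < 2c·c. Hence 3N = c²,
-- so 3 ∣ c, and writing c = 3t gives N = 3t².
module Submission where

open import Defs
open import Data.Nat using (ℕ; zero; suc; _*_; _≤_; _<_; z≤n; s≤s)
open import Data.Nat.Properties
open import Data.Nat.Divisibility using (_∣_; divides)
open import Data.Nat.Primality using (Prime; prime?; prime⇒nonZero; euclidsLemma)
open import Data.Nat.Tactic.RingSolver using (solve-∀)
open import Data.Product using (_×_; ∃-syntax; _,_)
open import Data.Sum using (inj₁; inj₂)
open import Data.Unit using (tt)
open import Data.Empty using (⊥-elim)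
open import Relation.Nullary using (yes; no)
open import Relation.Nullary.Decidable using (toWitness)
open import Relation.Binary.PropositionalEquality
open import Function.Bundles using (_⇔_; mk⇔)

private
  variable
    k c d m n p s : ℕ

m*m≤n*n⇒m≤n : m * m ≤ n * n → m ≤ n
m*m≤n*n⇒m≤n {m} {n} m²≤n² with m ≤? n
... | yes m≤n = m≤n
... | no  m≰n = ⊥-elim (<⇒≱ (*-mono-< (≰⇒> m≰n) (≰⇒> m≰n)) m²≤n²)

isCeilSqrt-unique : IsCeilSqrt k c → IsCeilSqrt k d → c ≡ d
isCeilSqrt-unique (k≤c² , c-least) (k≤d² , d-least) =
  ≤-antisym (c-least _ k≤d²) (d-least _ k≤c²)

isCeilSqrt-square : ∀ s → IsCeilSqrt (s * s) s
isCeilSqrt-square s = ≤-refl , λ _ → m*m≤n*n⇒m≤n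

isCeilSqrt-exists : ∀ k → ∃[ c ] IsCeilSqrt k c
isCeilSqrt-exists zero = 0 , z≤n , λ _ _ → z≤n
isCeilSqrt-exists (suc k) with isCeilSqrt-exists k
... | c , k≤c² , c-least with suc k ≤? c * c
...   | yes k<c² = c , k<c² , λ d k<d² → c-least d (≤-trans (n≤1+n k) k<d²)
...   | no  k≮c² = suc c , 1+k≤[1+c]² , 1+c-least
  where
  k≡c² : k ≡ c * c
  k≡c² = ≤∧≮⇒≡ k≤c² k≮c²

  1+k≤[1+c]² : suc k ≤ suc c * suc c
  1+k≤[1+c]² rewrite k≡c² = *-mono-< (n<1+n c) (n<1+n c)

  1+c-least : ∀ d → suc k ≤ d * d → suc c ≤ d
  1+c-least d 1+k≤d² with c <? d
  ... | yes c<d = c<d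
  ... | no  c≮d = ⊥-elim (<⇒≱ (subst (_≤ d * d) (cong suc k≡c²) 1+k≤d²)
                                (*-mono-≤ (≮⇒≥ c≮d) (≮⇒≥ c≮d)))

isCeilMulSqrt-square : ∀ m s → IsCeilMulSqrt m (s * s) (m * s)
isCeilMulSqrt-square m s =
  subst (λ k → IsCeilSqrt k (m * s)) (square-of-product m s) (isCeilSqrt-square (m * s))
  where
  square-of-product : ∀ m s → m * s * (m * s) ≡ m * m * (s * s)
  square-of-product = solve-∀

square⇒isCeilMulSqrt : k ≡ s * s → IsCeilSqrt k c → IsCeilMulSqrt m k (m * c)
square⇒isCeilMulSqrt {s = s} {c} {m} refl ceil =
  subst (λ c → IsCeilMulSqrt m (s * s) (m * c))
        (isCeilSqrt-unique (isCeilSqrt-square s) ceil)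
        (isCeilMulSqrt-square m s)

<⇒≡suc : k < n → ∃[ u ] (n ≡ suc u × k ≤ u)
<⇒≡suc (s≤s k≤u) = _ , refl , k≤u

-- With c² = u + 1 this is 4c²k ≤ (2c² − 1)² for k ≤ c² − 1.
square-gap : ∀ u → k ≤ u → 4 * suc u * k ≤ suc (2 * u) * suc (2 * u)
square-gap {k} u k≤u = begin
  4 * suc u * k       ≤⟨ *-monoʳ-≤ (4 * suc u) k≤u ⟩
  4 * suc u * u       ≤⟨ n≤1+n _ ⟩
  suc (4 * suc u * u) ≡⟨ expand u ⟩
  suc (2 * u) * suc (2 * u) ∎
  where
  open ≤-Reasoning
  expand : ∀ u → suc (4 * suc u * u) ≡ suc (2 * u) * suc (2 * u)
  expand = solve-∀

isCeilMulSqrt-double-< : k < c * c → IsCeilMulSqrt (2 * c) k d → d < 2 * c * c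
isCeilMulSqrt-double-< {k} {c} {d} k<c² (_ , d-least) with <⇒≡suc k<c²
... | u , c²≡1+u , k≤u = begin-strict
  d             ≤⟨ d-least (suc (2 * u)) bound ⟩
  suc (2 * u)   <⟨ ≤-reflexive (sym (*-suc 2 u)) ⟩
  2 * suc u     ≡⟨ cong (2 *_) c²≡1+u ⟨
  2 * (c * c)   ≡⟨ *-assoc 2 c c ⟨
  2 * c * c     ∎
  where
  open ≤-Reasoning
  double-square : ∀ c k → 2 * c * (2 * c) * k ≡ 4 * (c * c) * k
  double-square = solve-∀
  bound : 2 * c * (2 * c) * k ≤ suc (2 * u) * suc (2 * u)
  bound = begin
    2 * c * (2 * c) * k ≡⟨ double-square c k ⟩
    4 * (c * c) * k     ≡⟨ cong (λ x → 4 * x * k) c²≡1+u ⟩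
    4 * suc u * k       ≤⟨ square-gap u k≤u ⟩
    suc (2 * u) * suc (2 * u) ∎

isCeilMulSqrt-double⇒square : IsCeilSqrt k c → IsCeilMulSqrt (2 * c) k (2 * c * c) → k ≡ c * c
isCeilMulSqrt-double⇒square {c = c} (k≤c² , _) ceil =
  ≤∧≮⇒≡ k≤c² (λ k<c² → <-irrefl refl (isCeilMulSqrt-double-< {c = c} k<c² ceil))

prime∣square⇒∣ : Prime p → p ∣ c * c → p ∣ c
prime∣square⇒∣ {c = c} prime-p p∣c² with euclidsLemma c c prime-p p∣c²
... | inj₁ p∣c = p∣c
... | inj₂ p∣c = p∣c

p*n≡square⇒n≡p*square : Prime p → p * n ≡ c * c → ∃[ t ] (n ≡ p * (t * t))
p*n≡square⇒n≡p*square {p} {n} {c} prime-p pn≡c²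
  with prime∣square⇒∣ {c = c} prime-p (divides n (trans (sym pn≡c²) (*-comm p n)))
... | divides t refl = t , *-cancelˡ-≡ n (p * (t * t)) p (trans pn≡c² (regroup t p))
  where
  instance _ = prime⇒nonZero prime-p
  regroup : ∀ t p → t * p * (t * p) ≡ p * (p * (t * t))
  regroup = solve-∀

prime-3 : Prime 3
prime-3 = toWitness {a? = prime? 3} tt

lemma3 : (N : ℕ) → 1 ≤ N →
    ((∀ (m : ℕ) → 2 ≤ m → ∀ (c : ℕ) → IsCeilSqrt (3 * N) c → IsCeilMulSqrt m (3 * N) (m * c))
    ⇔ (∃[ t ] ((1 ≤ t) × (N ≡ 3 * (t * t)))))
lemma3 N 1≤N = mk⇔ only-if if
  where
  if : ∃[ t ] ((1 ≤ t) × (N ≡ 3 * (t * t))) →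
       ∀ m → 2 ≤ m → ∀ c → IsCeilSqrt (3 * N) c → IsCeilMulSqrt m (3 * N) (m * c)
  if (t , _ , N≡3t²) m _ c = square⇒isCeilMulSqrt {s = 3 * t} {m = m} (begin
    3 * N             ≡⟨ cong (3 *_) N≡3t² ⟩
    3 * (3 * (t * t)) ≡⟨ regroup t ⟩
    3 * t * (3 * t)   ∎)
    where
    open ≡-Reasoning
    regroup : ∀ t → 3 * (3 * (t * t)) ≡ 3 * t * (3 * t)
    regroup = solve-∀

  only-if : (∀ m → 2 ≤ m → ∀ c → IsCeilSqrt (3 * N) c → IsCeilMulSqrt m (3 * N) (m * c)) →
            ∃[ t ] ((1 ≤ t) × (N ≡ 3 * (t * t)))
  only-if exact with isCeilSqrt-exists (3 * N)
  ... | c , ceil@(3N≤c² , _) with p*n≡square⇒n≡p*square {c = c} prime-3 3N≡c²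
    where
    1≤c : 1 ≤ c
    1≤c = m*m≤n*n⇒m≤n (≤-trans 1≤N (≤-trans (m≤n*m N 3) 3N≤c²))
    3N≡c² : 3 * N ≡ c * c
    3N≡c² = isCeilMulSqrt-double⇒square {c = c} ceil (exact (2 * c) (*-monoʳ-≤ 2 1≤c) c ceil)
  ... | zero  , N≡0   = ⊥-elim (<⇒≱ 1≤N (≤-reflexive N≡0))
  ... | suc t , N≡3t² = suc t , s≤s z≤n , N≡3t²
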